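{- The meet-compact L$_1$-models form a Hennessy-Milner class: for all meet-compact L$_1$-models $\mathfrak{M}=(W,1,\curlywedge,V)$, $\mathfrak{M}'=(W',1',\curlywedge',V')$ and states $w\in W$, $w'\in W'$, we have $\mathrm{th}_{\mathfrak{M}}(w)\subseteq\mathrm{th}_{\mathfrak{M}'}(w')$ if and only if there exists an L$_1$-simulation $S$ from $\mathfrak{M}$ to $\mathfrak{M}'$ with $(w,w')\in S$.
   Context: $\mathcal{L}$ is generated by $\phi ::= p\mid\top\mid\bot\mid\phi\wedge\phi\mid\phi\vee\phi$, $p$ in a fixed set $\mathrm{Prop}$. A meet-semilattice $(W,1,\curlywedge)$ is a poset in which every finite subset has a meet; $\curlywedge$ binary meet, $1$ top, $w\preccurlyeq v$ iff $w\curlywedge v=w$. A filter is a $\preccurlyeq$-upward closed subset closed under finite meets. An L$_1$-model $(W,1,\curlywedge,V)$ is a meet-semilattice with $V(p)$ a filter for each $p$. Satisfaction: $w\Vdash p$ iff $w\in V(p)$; $w\Vdash\top$ always; $w\Vdash\bot$ iff $w=1$; $\wedge$ classical; $w\Vdash\phi_1\vee\phi_2$ iff there are $u,v$ with $u\curlywedge v\preccurlyeq w$, $u\Vdash\phi_1$, $v\Vdash\phi_2$. $\mathrm{th}_{\mathfrak{M}}(w)=\{\phi\in\mathcal{L}\mid\mathfrak{M},w\Vdash\phi\}$, $[\![\phi]\!]=\{w\mid w\Vdash\phi\}$. $\tau_V$ is the topology on $W$ generated by the subbase $\{[\![\phi]\!]\}\cup\{W\setminus[\![\phi]\!]\}$,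 $\phi\in\mathcal{L}$. $\mathfrak{M}$ is meet-compact if for all $w\in W$ the set $\{(v,u)\in W\times W\mid v\curlywedge u\preccurlyeq w\}$ is compact in $(W,\tau_V)\times(W,\tau_V)$. An L$_1$-simulation from $\mathfrak{M}$ to $\mathfrak{M}'$ is $S\subseteq W\times W'$ such that for all $(w,w')\in S$: (S1) $w\in V(p)$ implies $w'\in V'(p)$ for all $p$; (S2) $w=1$ implies $w'=1'$; (S3) if $v\curlywedge u\preccurlyeq w$ then there exist $v',u'\in W'$ with $(v,v'),(u,u')\in S$ and $v'\curlywedge'u'\preccurlyeq' w'$. -}

module Defs where

open import Level using (0ℓ)
open import Data.Bool using (Bool; true; false)
open import Data.Empty using (⊥)
open import Data.Unit using (⊤)
open import Data.List using (List; []; _∷_)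
open import Data.List.Membership.Propositional using (_∈_)
open import Data.Product using (Σ; ∃; ∃-syntax; _×_; _,_; proj₁; proj₂)
open import Relation.Nullary using (¬_)
open import Relation.Binary.PropositionalEquality using (_≡_)
open import Algebra.Structures using (IsIdempotentCommutativeMonoid)

data Form (Prop : Set) : Set where
  atom : Prop → Form Prop
  tt   : Form Prop
  ff   : Form Prop
  _∧̇_  : Form Prop → Form Prop → Form Prop
  _∨̇_  : Form Prop → Form Prop → Form Prop

record IsFilter {W : Set} (_⋏_ : W → W → W) (𝟏 : W) (F : W → Set) : Set where
  field
    upward : ∀ {w v} → F w → w ⋏ v ≡ w → F v
    top    : F 𝟏
    meet   : ∀ {w v} → F w → F v → F (w ⋏ v)

record L1Model (Prop : Set) : Set₁ where
  infixr 7 _⋏_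
  field
    W      : Set
    𝟏      : W
    _⋏_    : W → W → W
    isMeetSemilattice : IsIdempotentCommutativeMonoid _≡_ _⋏_ 𝟏
    V        : Prop → W → Set
    V-filter : ∀ p → IsFilter _⋏_ 𝟏 (V p)

  infix 4 _≼_
  _≼_ : W → W → Set
  w ≼ v = w ⋏ v ≡ w

  infix 3 _⊩_
  _⊩_ : W → Form Prop → Set
  w ⊩ atom p  = V p w
  w ⊩ tt      = ⊤
  w ⊩ ff      = w ≡ 𝟏
  w ⊩ φ ∧̇ ψ   = (w ⊩ φ) × (w ⊩ ψ)
  w ⊩ φ ∨̇ ψ   = ∃[ u ] ∃[ v ] ((u ⋏ v ≼ w) × (u ⊩ φ) × (v ⊩ ψ))

  ⟦_⟧ : Form Prop → W → Set
  ⟦ φ ⟧ w = w ⊩ φ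

  th : W → Form Prop → Set
  th w φ = w ⊩ φ

  -- The topology τ_V generated by the subbase
  --   { [[φ]] } ∪ { W ∖ [[φ]] }  (φ ∈ L).
  -- A subbase element is given by (φ , true) ↦ [[φ]] and
  -- (φ , false) ↦ W ∖ [[φ]].

  subbasic : Form Prop × Bool → W → Set
  subbasic (φ , true)  w = w ⊩ φ
  subbasic (φ , false) w = ¬ (w ⊩ φ)

  basic : List (Form Prop × Bool) → W → Set
  basic []       w = ⊤
  basic (s ∷ ss) w = subbasic s w × basic ss w

  -- open sets of τ_V: unions of basic open sets, i.e. every point of
  -- the set lies in a basic open set contained in the set
  IsOpen : (W → Set) → Set
  IsOpen O = ∀ w → O w → ∃[ b ] (basic b w × (∀ v → basic b v → O v))

  IsOpen² : (W × W → Set) → Set₁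
  IsOpen² O = ∀ x → O x →
    ∃[ U ] ∃[ U' ] (IsOpen U × IsOpen U' × U (proj₁ x) × U' (proj₂ x)
                    × (∀ y → U (proj₁ y) → U' (proj₂ y) → O y))

  IsCompact² : (W × W → Set) → Set₁
  IsCompact² K =
    (I : Set) (O : I → W × W → Set) →
    (∀ i → IsOpen² (O i)) →
    (∀ x → K x → ∃[ i ] O i x) →
    ∃[ is ] (∀ x → K x → ∃[ i ] (i ∈ is × O i x))

  MeetCompact : Set₁
  MeetCompact = ∀ w → IsCompact² (λ x → proj₁ x ⋏ proj₂ x ≼ w)

open L1Model public

record IsL1Simulation {Prop : Set} (M M' : L1Model Prop)
                      (S : W M → W M' → Set) : Set where
  private
    module M  = L1Model M
    module M' = L1Model M'
  field
    S1 : ∀ {w w'} → S w w' → ∀ p → M.V p w → M'.V p w'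
    S2 : ∀ {w w'} → S w w' → w ≡ M.𝟏 → w' ≡ M'.𝟏
    S3 : ∀ {w w'} → S w w' → ∀ v u → (v M.⋏ u) M.≼ w →
         ∃[ v' ] ∃[ u' ] (S v v' × S u u' × ((v' M'.⋏ u') M'.≼ w'))

-- Conversely,
-- theory inclusion is itself a simulation: (S1) and (S2) are its instances at
-- atoms and at ⊥, and (S3) is where compactness enters.  If v ⋏ u ≼ w admitted
-- no pair v' ⋏' u' ≼' w' with th(v) ⊆ th(v') and th(u) ⊆ th(u'), the open sets
-- {(x , y) | x ⊮ φ or y ⊮ ψ} for v ⊩ φ, u ⊩ ψ would cover the compact set
-- {(x , y) | x ⋏' y ≼' w'}.  A finite subcover yields conjunctions Φ, Ψ with
-- v ⊩ Φ and u ⊩ Ψ, so w ⊩ Φ ∨ Ψ, whereas no pair below w' satisfies Φ and Ψ,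
-- so w' ⊮ Φ ∨ Ψ.  Only the target model needs to be meet-compact.
module Submission where

open import Defs
open import Level using (0ℓ)
open import Axiom.ExcludedMiddle using (ExcludedMiddle)
open import Axiom.DoubleNegationElimination using (DoubleNegationElimination; em⇒dne)
open import Data.Bool using (false)
open import Data.List using (List; []; _∷_; map; foldr)
open import Data.List.Membership.Propositional using (_∈_)
open import Data.List.Membership.Propositional.Properties using (∈-map⁺)
open import Data.List.Relation.Unary.All as All using (All; []; _∷_)
import Data.List.Relation.Unary.All.Properties as All
open import Data.Product using (Σ; ∃-syntax; _×_; _,_; proj₁; proj₂)
open import Data.Sum using (_⊎_; inj₁; inj₂)
open import Data.Unit using (⊤)
import Data.Unit as Unit
open import Function.Bundles using (_⇔_; mk⇔)
open import Relation.Nullary using (¬_)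

private
  variable
    Prop : Set

⋀ : List (Form Prop) → Form Prop
⋀ = foldr _∧̇_ tt

TheoryInclusion : (M M' : L1Model Prop) → W M → W M' → Set
TheoryInclusion M M' w w' = ∀ φ → th M w φ → th M' w' φ

module _ (M : L1Model Prop) where
  private module M = L1Model M

  ⊩-⋀⁺ : ∀ {w} φs → All (M._⊩_ w) φs → M._⊩_ w (⋀ φs)
  ⊩-⋀⁺ []       []       = Unit.tt
  ⊩-⋀⁺ (_ ∷ φs) (h ∷ hs) = h , ⊩-⋀⁺ φs hs

  ⊩-⋀⁻ : ∀ {w} φs → M._⊩_ w (⋀ φs) → All (M._⊩_ w) φs
  ⊩-⋀⁻ []       _        = []
  ⊩-⋀⁻ (_ ∷ φs) (h , hs) = h ∷ ⊩-⋀⁻ φs hs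

  ∁⟦⟧-isOpen : ∀ φ → M.IsOpen (λ z → ¬ M._⊩_ z φ)
  ∁⟦⟧-isOpen φ z z⊮φ = (φ , false) ∷ [] , (z⊮φ , Unit.tt) , λ _ → proj₁

  full-isOpen : M.IsOpen (λ _ → ⊤)
  full-isOpen _ _ = [] , Unit.tt , _

  proj₁⁻¹-isOpen² : ∀ {U} → M.IsOpen U → M.IsOpen² (λ x → U (proj₁ x))
  proj₁⁻¹-isOpen² U-open x Ux =
    _ , _ , U-open , full-isOpen , Ux , Unit.tt , λ _ Uy _ → Uy

  proj₂⁻¹-isOpen² : ∀ {U} → M.IsOpen U → M.IsOpen² (λ x → U (proj₂ x))
  proj₂⁻¹-isOpen² U-open x Ux =
    _ , _ , full-isOpen , U-open , Unit.tt , Ux , λ _ _ Uy → Uy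

  ∪-isOpen² : ∀ {O O'} → M.IsOpen² O → M.IsOpen² O' →
              M.IsOpen² (λ x → O x ⊎ O' x)
  ∪-isOpen² O-open O'-open x (inj₁ Ox) with O-open x Ox
  ... | U , U' , Uo , U'o , Ux , U'x , U×U'⊆O =
    U , U' , Uo , U'o , Ux , U'x , λ y Uy U'y → inj₁ (U×U'⊆O y Uy U'y)
  ∪-isOpen² O-open O'-open x (inj₂ O'x) with O'-open x O'x
  ... | U , U' , Uo , U'o , Ux , U'x , U×U'⊆O' =
    U , U' , Uo , U'o , Ux , U'x , λ y Uy U'y → inj₂ (U×U'⊆O' y Uy U'y)

module _ (M M' : L1Model Prop) where
  private
    module M  = L1Model M
    module M' = L1Model M'

  simulation⇒theoryInclusion : ∀ {S} → IsL1Simulation M M' S →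
                               ∀ {w w'} → S w w' → TheoryInclusion M M' w w'
  simulation⇒theoryInclusion {S} sim = preserve
    where
    open IsL1Simulation sim
    preserve : ∀ {w w'} → S w w' → TheoryInclusion M M' w w'
    preserve wSw' (atom p) w⊩p = S1 wSw' p w⊩p
    preserve wSw' tt       _   = Unit.tt
    preserve wSw' ff       w≡𝟏 = S2 wSw' w≡𝟏
    preserve wSw' (φ ∧̇ ψ)  (w⊩φ , w⊩ψ) = preserve wSw' φ w⊩φ , preserve wSw' ψ w⊩ψ
    preserve wSw' (φ ∨̇ ψ)  (v , u , v⋏u≼w , v⊩φ , u⊩ψ)
      with S3 wSw' v u v⋏u≼w
    ... | v' , u' , vSv' , uSu' , v'⋏u'≼w' =
      v' , u' , v'⋏u'≼w' , preserve vSv' φ v⊩φ , preserve uSu' ψ u⊩ψ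

  module _ (v u : M.W) (w' : M'.W) where

    MatchingPairBelow : Set
    MatchingPairBelow = ∃[ v' ] ∃[ u' ]
      (TheoryInclusion M M' v v' × TheoryInclusion M M' u u' × v' M'.⋏ u' M'.≼ w')

    Refuter : Set
    Refuter = Σ (Form Prop × Form Prop) λ (φ , ψ) → M._⊩_ v φ × M._⊩_ u ψ

    refutes : Refuter → M'.W × M'.W → Set
    refutes ((φ , ψ) , _) (x , y) = ¬ M'._⊩_ x φ ⊎ ¬ M'._⊩_ y ψ

    refutes-isOpen² : ∀ i → M'.IsOpen² (refutes i)
    refutes-isOpen² ((φ , ψ) , _) =
      ∪-isOpen² M' (proj₁⁻¹-isOpen² M' (∁⟦⟧-isOpen M' φ))
                   (proj₂⁻¹-isOpen² M' (∁⟦⟧-isOpen M' ψ))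

    -- A pair padded with tt refutes through its other component alone.
    refuters-cover : DoubleNegationElimination 0ℓ → ¬ MatchingPairBelow →
                     ∀ x → proj₁ x M'.⋏ proj₂ x M'.≼ w' → ∃[ i ] refutes i x
    refuters-cover dne no-pair (x , y) x⋏y≼w' = dne λ unrefuted →
      no-pair (x , y ,
               (λ φ v⊩φ → dne λ x⊮φ → unrefuted (((φ , tt) , v⊩φ , Unit.tt) , inj₁ x⊮φ)) ,
               (λ ψ u⊩ψ → dne λ y⊮ψ → unrefuted (((tt , ψ) , Unit.tt , u⊩ψ) , inj₂ y⊮ψ)) ,
               x⋏y≼w')

    no-finite-refuting-cover :
      ∀ {w} → TheoryInclusion M M' w w' → v M.⋏ u M.≼ w →
      (is : List Refuter) →
      ¬ (∀ x → proj₁ x M'.⋏ proj₂ x M'.≼ w' → ∃[ i ] (i ∈ is × refutes i x))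
    no-finite-refuting-cover w⊆w' v⋏u≼w is covers
      with w⊆w' (Φ ∨̇ Ψ) (v , u , v⋏u≼w , ⊩-⋀⁺ M Φs v⊩Φs , ⊩-⋀⁺ M Ψs u⊩Ψs)
      where
      Φs Ψs : List (Form Prop)
      Φs = map (λ i → proj₁ (proj₁ i)) is
      Ψs = map (λ i → proj₂ (proj₁ i)) is
      Φ Ψ : Form Prop
      Φ = ⋀ Φs
      Ψ = ⋀ Ψs
      v⊩Φs : All (M._⊩_ v) Φs
      v⊩Φs = All.map⁺ (All.tabulate λ {i} _ → proj₁ (proj₂ i))
      u⊩Ψs : All (M._⊩_ u) Ψs
      u⊩Ψs = All.map⁺ (All.tabulate λ {i} _ → proj₂ (proj₂ i))
    ... | x , y , x⋏y≼w' , x⊩Φ , y⊩Ψ with covers (x , y) x⋏y≼w'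
    ...   | i , i∈is , inj₁ x⊮φ =
      x⊮φ (All.lookup (⊩-⋀⁻ M' _ x⊩Φ) (∈-map⁺ (λ i → proj₁ (proj₁ i)) i∈is))
    ...   | i , i∈is , inj₂ y⊮ψ =
      y⊮ψ (All.lookup (⊩-⋀⁻ M' _ y⊩Ψ) (∈-map⁺ (λ i → proj₂ (proj₁ i)) i∈is))

    theoryInclusion-matchesMeet :
      DoubleNegationElimination 0ℓ → MeetCompact M' →
      ∀ {w} → TheoryInclusion M M' w w' → v M.⋏ u M.≼ w → MatchingPairBelow
    theoryInclusion-matchesMeet dne compact w⊆w' v⋏u≼w = dne λ no-pair →
      let is , finite-cover = compact w' Refuter refutes refutes-isOpen²
                                      (refuters-cover dne no-pair)
      in no-finite-refuting-cover w⊆w' v⋏u≼w is finite-cover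

  theoryInclusion-isL1Simulation : DoubleNegationElimination 0ℓ → MeetCompact M' →
                                   IsL1Simulation M M' (TheoryInclusion M M')
  theoryInclusion-isL1Simulation dne compact = record
    { S1 = λ w⊆w' p → w⊆w' (atom p)
    ; S2 = λ w⊆w' → w⊆w' ff
    ; S3 = λ {_} {w'} w⊆w' v u →
             theoryInclusion-matchesMeet v u w' dne compact w⊆w'
    }

theorem5p6 : ExcludedMiddle 0ℓ →
    ∀ {Prop : Set} (M M' : L1Model Prop) →
    MeetCompact M → MeetCompact M' →
    (w : W M) (w' : W M') →
    (∀ φ → th M w φ → th M' w' φ)
      ⇔ (∃[ S ] (IsL1Simulation M M' S × S w w'))
theorem5p6 em M M' _ compact' w w' = mk⇔
  (λ w⊆w' → TheoryInclusion M M' ,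
            theoryInclusion-isL1Simulation M M' (em⇒dne em) compact' , w⊆w')
  (λ (S , sim , wSw') → simulation⇒theoryInclusion M M' sim wSw')
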